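{- For a positive integer $k$, let \[ \mathcal D_k(q)=\frac{q^{k^2}}{(1-q)^2(1-q^2)^2\cdots(1-q^k)^2}, \] and for $1\le \ell\le 2k$ let $c_{0,1,\ell}(k)$ denote the coefficient of $(q-1)^{ -\ell}$ in the principal part of the Laurent expansion of $\mathcal D_k(q)$ about $q=1$. Equivalently, $c_{0,1,\ell}(k)$ is the coefficient of $1/\Phi_1^\ell$, with $\Phi_1=q-1$, in the partial fraction decomposition of $\mathcal D_k$ over the cyclotomic polynomials. Then for every $k\ge 1$, \[ c_{0,1,2k}(k)=\frac{1}{(k!)^2},\qquad c_{0,1,2k-1}(k)=\frac{k+1}{2(k-1)!\,k!}, \] and for every $k\ge 2$, \[ c_{0,1,2k-2}(k)=\frac{9k^2+25k+13}{72(k-2)!\,k!},\qquad c_{0,1,2k-3}(k)=\frac{3k^4+10k^3-4k^2-31k-14}{144(k-2)!\,k!}. \]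
   Context: $\mathcal D_k(q)=\sum_{n\ge k^2}D(n,k)q^n$ is the generating function of the number $D(n,k)$ of partitions of $n$ with Durfee square of order $k$. It has a pole of order $2k$ at $q=1$. Its partial fraction decomposition has the form \[ \mathcal D_k=\sum_{j=1}^k\sum_{\ell=1}^{2\lfloor k/j\rfloor}\sum_{h=0}^{\varphi(j)-1}\frac{c_{h,j,\ell}(k)q^h}{\Phi_j^\ell}, \] where $\Phi_j$ is the $j$th cyclotomic polynomial and $\varphi$ is Euler's totient function. -}

module Defs where

open import Data.Nat as ℕ using (ℕ; zero; suc)
open import Data.Nat.Base using (_!)
open import Data.Nat.Properties using (_!≢0)
open import Data.Integer as ℤ using (ℤ; +_; -[1+_])
open import Data.Rational as ℚ using (ℚ; 0ℚ; 1ℚ)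
open import Data.List using (List; []; _∷_; length; foldr)
open import Data.Product using (∃; _×_)
open import Relation.Binary.PropositionalEquality using (_≡_)

-- Polynomials with rational coefficients, as ascending coefficient lists
-- [a₀, a₁, …] representing a₀ + a₁ x + a₂ x² + ….
Poly : Set
Poly = List ℚ

_+ₚ_ : Poly → Poly → Poly
[] +ₚ q = q
(a ∷ p) +ₚ [] = a ∷ p
(a ∷ p) +ₚ (b ∷ q) = (a ℚ.+ b) ∷ (p +ₚ q)

scaleₚ : ℚ → Poly → Poly
scaleₚ c [] = []
scaleₚ c (a ∷ p) = (c ℚ.* a) ∷ scaleₚ c p

_*ₚ_ : Poly → Poly → Poly
[] *ₚ q = []
(a ∷ p) *ₚ q = scaleₚ a q +ₚ (0ℚ ∷ (p *ₚ q))

oneₚ : Poly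
oneₚ = 1ℚ ∷ []

monoₚ : ℕ → Poly
monoₚ zero = oneₚ
monoₚ (suc n) = 0ℚ ∷ monoₚ n

oneMinusPow : ℕ → Poly
oneMinusPow j = oneₚ +ₚ scaleₚ (ℚ.- 1ℚ) (monoₚ j)

coeff : Poly → ℕ → ℚ
coeff [] n = 0ℚ
coeff (a ∷ p) zero = a
coeff (a ∷ p) (suc n) = coeff p n

coeffℤ : Poly → ℤ → ℚ
coeffℤ p (+ n) = coeff p n
coeffℤ p -[1+ n ] = 0ℚ

-- Taylor shift: given p(q), returns the polynomial p(1 + t) in t.
shift1 : Poly → Poly
shift1 = foldr (λ a acc → (a ∷ []) +ₚ (acc +ₚ (0ℚ ∷ acc))) []

numD : ℕ → Poly
numD k = monoₚ (k ℕ.* k)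

denD : ℕ → Poly
denD zero = oneₚ
denD (suc k) = denD k *ₚ (oneMinusPow (suc k) *ₚ oneMinusPow (suc k))

Σ< : ℕ → (ℕ → ℚ) → ℚ
Σ< zero f = 0ℚ
Σ< (suc n) f = Σ< n f ℚ.+ f n

-- A formal Laurent series in t = q - 1 is c : ℤ → ℚ (c n = coefficient of
-- (q-1)^n) whose support is bounded below.  It is the Laurent expansion of
-- 𝒟_k = numD k / denD k about q = 1 iff c · denD k (1+t) = numD k (1+t)
-- as formal Laurent series in t (Cauchy product, finite since the
-- denominator is a polynomial).
IsLaurentExpansionD : ℕ → (ℤ → ℚ) → Set
IsLaurentExpansionD k c =
  (∃ λ (M : ℕ) → ∀ (n : ℤ) → n ℤ.< ℤ.- (+ M) → c n ≡ 0ℚ)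
  × (∀ (n : ℤ) →
       Σ< (length (shift1 (denD k)))
          (λ i → coeff (shift1 (denD k)) i ℚ.* c (n ℤ.- (+ i)))
       ≡ coeffℤ (shift1 (numD k)) n)

inv! : ℕ → ℚ
inv! n = (+ 1) ℚ./ (n !)
  where instance _ = n !≢0

-- Put q = 1 + t.  Since 1 - (1+t)^j = t · Y_j(t) with Y_j(t) = -Σ_{i≥0} C(j,i+1) t^i,
-- the shifted denominator is t^{2k} · E_k(t), where E_k = ∏_{j ≤ k} Y_j² has constant
-- term (k!)².  Hence the Laurent expansion is c(n - 2k) = f(n), where f is the power
-- series quotient (1+t)^{k²} / E_k(t), i.e. the solution of the triangular system
-- Σ_{j ≤ m} E_k[j] · f(m - j) = C(k², m).

module Submission where

open import Defs
open import Data.Nat as ℕ using (ℕ; _≥_; _∸_; zero; suc; z≤n; s≤s; NonZero)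
open import Data.Nat.Base using (_!)
import Data.Nat.Properties as ℕP
open import Data.Nat.Induction using (<-rec)
open import Data.Integer as ℤ using (ℤ; +_; -[1+_])
open import Data.Integer.Base using (_⊖_)
import Data.Integer.Properties as ℤP
import Data.Integer.Solver as ℤSolver
open import Data.Rational as ℚ using (ℚ; 0ℚ; 1ℚ)
import Data.Rational.Properties as ℚP
import Data.Rational.Unnormalised as ℚᵘ
import Data.Rational.Unnormalised.Properties as ℚᵘP
open import Data.Rational.Unnormalised using (mkℚᵘ; *≡*)
open import Data.Rational.Base using (fromℚᵘ)
open import Data.Rational.Solver
open +-*-Solver using (solve; _:=_; _:+_; _:*_; _:-_; con; var; Polynomial; ⟦_⟧)
open import Algebra.Properties.Group ℚP.+-0-group using (∙-cancelʳ)
open import Data.Fin using () renaming (zero to fzero)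
import Data.Vec as Vec
open import Data.List using ([]; _∷_; length)
open import Data.Product using (∃; _×_; _,_; proj₁; proj₂)
open import Data.Empty using (⊥-elim)
open import Relation.Nullary using (yes; no; ¬_)
open import Relation.Binary.PropositionalEquality
  using (_≡_; refl; sym; trans; cong; cong₂; subst)
open Relation.Binary.PropositionalEquality.≡-Reasoning

Σ<-ext : ∀ n {f g : ℕ → ℚ} → (∀ i → i ℕ.< n → f i ≡ g i) → Σ< n f ≡ Σ< n g
Σ<-ext zero h = refl
Σ<-ext (suc n) h = cong₂ ℚ._+_ (Σ<-ext n (λ i i<n → h i (ℕP.m<n⇒m<1+n i<n))) (h n ℕP.≤-refl)

Σ<-zero : ∀ n {f : ℕ → ℚ} → (∀ i → i ℕ.< n → f i ≡ 0ℚ) → Σ< n f ≡ 0ℚ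
Σ<-zero zero h = refl
Σ<-zero (suc n) h =
  cong₂ ℚ._+_ (Σ<-zero n (λ i i<n → h i (ℕP.m<n⇒m<1+n i<n))) (h n ℕP.≤-refl)

Σ<-pad : ∀ a x (f : ℕ → ℚ) → (∀ i → a ℕ.≤ i → f i ≡ 0ℚ) → Σ< (a ℕ.+ x) f ≡ Σ< a f
Σ<-pad a zero f h rewrite ℕP.+-identityʳ a = refl
Σ<-pad a (suc x) f h rewrite ℕP.+-suc a x =
  trans (cong₂ ℚ._+_ (Σ<-pad a x f h) (h (a ℕ.+ x) (ℕP.m≤m+n a x))) (ℚP.+-identityʳ (Σ< a f))

Σ<-trunc : ∀ a b (f : ℕ → ℚ) → (∀ i → a ℕ.≤ i → f i ≡ 0ℚ) → (∀ i → b ℕ.≤ i → f i ≡ 0ℚ) →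
           Σ< a f ≡ Σ< b f
Σ<-trunc a b f ha hb = begin
  Σ< a f          ≡⟨ sym (Σ<-pad a b f ha) ⟩
  Σ< (a ℕ.+ b) f  ≡⟨ cong (λ n → Σ< n f) (ℕP.+-comm a b) ⟩
  Σ< (b ℕ.+ a) f  ≡⟨ Σ<-pad b a f hb ⟩
  Σ< b f          ∎

Σ<-split : ∀ a b (f : ℕ → ℚ) → Σ< (a ℕ.+ b) f ≡ Σ< a f ℚ.+ Σ< b (λ j → f (a ℕ.+ j))
Σ<-split a zero f rewrite ℕP.+-identityʳ a = sym (ℚP.+-identityʳ (Σ< a f))
Σ<-split a (suc b) f rewrite ℕP.+-suc a b =
  trans (cong (ℚ._+ f (a ℕ.+ b)) (Σ<-split a b f))
        (ℚP.+-assoc (Σ< a f) (Σ< b (λ j → f (a ℕ.+ j))) (f (a ℕ.+ b)))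

Σ<-head : ∀ n (f : ℕ → ℚ) → Σ< (suc n) f ≡ f 0 ℚ.+ Σ< n (λ j → f (suc j))
Σ<-head zero f = trans (ℚP.+-identityˡ (f 0)) (sym (ℚP.+-identityʳ (f 0)))
Σ<-head (suc n) f =
  trans (cong (ℚ._+ f (suc n)) (Σ<-head n f))
        (ℚP.+-assoc (f 0) (Σ< n (λ j → f (suc j))) (f (suc n)))

Σ<-+ : ∀ n (f g : ℕ → ℚ) → Σ< n (λ i → f i ℚ.+ g i) ≡ Σ< n f ℚ.+ Σ< n g
Σ<-+ zero f g = refl
Σ<-+ (suc n) f g = trans (cong (ℚ._+ (f n ℚ.+ g n)) (Σ<-+ n f g))
  (solve 4 (λ A B C D → (A :+ B) :+ (C :+ D) := (A :+ C) :+ (B :+ D)) refl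
     (Σ< n f) (Σ< n g) (f n) (g n))

Σ<-scale : ∀ n (c : ℚ) (f : ℕ → ℚ) → Σ< n (λ i → c ℚ.* f i) ≡ c ℚ.* Σ< n f
Σ<-scale zero c f = sym (ℚP.*-zeroʳ c)
Σ<-scale (suc n) c f =
  trans (cong (ℚ._+ (c ℚ.* f n)) (Σ<-scale n c f)) (sym (ℚP.*-distribˡ-+ c _ _))

Σ<-reverse : ∀ n (f : ℕ → ℚ) → Σ< (suc n) (λ i → f (n ∸ i)) ≡ Σ< (suc n) f
Σ<-reverse zero f = refl
Σ<-reverse (suc n) f = begin
  Σ< (suc (suc n)) (λ i → f (suc n ∸ i))      ≡⟨ Σ<-head (suc n) (λ i → f (suc n ∸ i)) ⟩
  f (suc n) ℚ.+ Σ< (suc n) (λ j → f (n ∸ j))  ≡⟨ cong (f (suc n) ℚ.+_) (Σ<-reverse n f) ⟩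
  f (suc n) ℚ.+ Σ< (suc n) f                  ≡⟨ ℚP.+-comm (f (suc n)) (Σ< (suc n) f) ⟩
  Σ< (suc (suc n)) f                          ∎

infixl 7 _⋆_

_⋆_ : (ℕ → ℚ) → (ℕ → ℚ) → ℕ → ℚ
(X ⋆ Z) n = Σ< (suc n) (λ i → X i ℚ.* Z (n ∸ i))

⋆-comm : ∀ X Z n → (X ⋆ Z) n ≡ (Z ⋆ X) n
⋆-comm X Z n = begin
  Σ< (suc n) (λ i → X i ℚ.* Z (n ∸ i))
    ≡⟨ sym (Σ<-reverse n (λ i → X i ℚ.* Z (n ∸ i))) ⟩
  Σ< (suc n) (λ i → X (n ∸ i) ℚ.* Z (n ∸ (n ∸ i)))
    ≡⟨ Σ<-ext (suc n) (λ i i≤n →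
         trans (cong (λ j → X (n ∸ i) ℚ.* Z j) (ℕP.m∸[m∸n]≡n (ℕP.≤-pred i≤n)))
               (ℚP.*-comm (X (n ∸ i)) (Z i))) ⟩
  Σ< (suc n) (λ i → Z i ℚ.* X (n ∸ i)) ∎

⋆-congˡ : ∀ {X X'} Z n → (∀ i → i ℕ.≤ n → X i ≡ X' i) → (X ⋆ Z) n ≡ (X' ⋆ Z) n
⋆-congˡ Z n h = Σ<-ext (suc n) (λ i i≤n → cong (ℚ._* Z (n ∸ i)) (h i (ℕP.≤-pred i≤n)))

⋆-congʳ : ∀ X {Z Z'} n → (∀ i → i ℕ.≤ n → Z i ≡ Z' i) → (X ⋆ Z) n ≡ (X ⋆ Z') n
⋆-congʳ X n h = Σ<-ext (suc n) (λ i _ → cong (X i ℚ.*_) (h (n ∸ i) (ℕP.m∸n≤m n i)))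

⋆-distribʳ-+ : ∀ X X' Z n → ((λ i → X i ℚ.+ X' i) ⋆ Z) n ≡ (X ⋆ Z) n ℚ.+ (X' ⋆ Z) n
⋆-distribʳ-+ X X' Z n =
  trans (Σ<-ext (suc n) (λ i _ → ℚP.*-distribʳ-+ (Z (n ∸ i)) (X i) (X' i))) (Σ<-+ (suc n) _ _)

⋆-scaleˡ : ∀ a X Z n → ((λ i → a ℚ.* X i) ⋆ Z) n ≡ a ℚ.* (X ⋆ Z) n
⋆-scaleˡ a X Z n =
  trans (Σ<-ext (suc n) (λ i _ → ℚP.*-assoc a (X i) (Z (n ∸ i)))) (Σ<-scale (suc n) a _)

δ : ℕ → ℚ
δ zero = 1ℚ
δ (suc _) = 0ℚ

⋆-identityˡ : ∀ Z n → (δ ⋆ Z) n ≡ Z n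
⋆-identityˡ Z n = begin
  (δ ⋆ Z) n                                         ≡⟨ Σ<-head n (λ i → δ i ℚ.* Z (n ∸ i)) ⟩
  1ℚ ℚ.* Z n ℚ.+ Σ< n (λ j → 0ℚ ℚ.* Z (n ∸ suc j))  ≡⟨ cong₂ ℚ._+_ (ℚP.*-identityˡ (Z n))
                                                        (Σ<-zero n (λ j _ → ℚP.*-zeroˡ (Z (n ∸ suc j)))) ⟩
  Z n ℚ.+ 0ℚ                                        ≡⟨ ℚP.+-identityʳ (Z n) ⟩
  Z n                                               ∎

⋆-zeroˡ : ∀ Z n → ((λ _ → 0ℚ) ⋆ Z) n ≡ 0ℚ
⋆-zeroˡ Z n = Σ<-zero (suc n) (λ i _ → ℚP.*-zeroˡ (Z (n ∸ i)))

delay : (ℕ → ℚ) → ℕ → ℚ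
delay X zero = 0ℚ
delay X (suc i) = X i

delay-cong : ∀ {X Y} → (∀ i → X i ≡ Y i) → ∀ i → delay X i ≡ delay Y i
delay-cong h zero = refl
delay-cong h (suc i) = h i

⋆-delayˡ : ∀ X Z n → (delay X ⋆ Z) n ≡ delay (X ⋆ Z) n
⋆-delayˡ X Z zero = trans (ℚP.+-identityˡ (0ℚ ℚ.* Z 0)) (ℚP.*-zeroˡ (Z 0))
⋆-delayˡ X Z (suc n) = trans (Σ<-head (suc n) (λ i → delay X i ℚ.* Z (suc n ∸ i)))
  (trans (cong (ℚ._+ (X ⋆ Z) n) (ℚP.*-zeroˡ (Z (suc n)))) (ℚP.+-identityˡ ((X ⋆ Z) n)))

delay-⋆-delay : ∀ W n → (delay W ⋆ delay W) n ≡ delay (delay (W ⋆ W)) n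
delay-⋆-delay W n = trans (⋆-delayˡ W (delay W) n)
  (delay-cong (λ m → trans (⋆-comm W (delay W) m) (⋆-delayˡ W W m)) n)

⋆-delay²ʳ : ∀ X W n → (X ⋆ delay (delay W)) n ≡ delay (delay (X ⋆ W)) n
⋆-delay²ʳ X W n = begin
  (X ⋆ delay (delay W)) n    ≡⟨ ⋆-comm X (delay (delay W)) n ⟩
  (delay (delay W) ⋆ X) n    ≡⟨ ⋆-delayˡ (delay W) X n ⟩
  delay (delay W ⋆ X) n      ≡⟨ delay-cong (⋆-delayˡ W X) n ⟩
  delay (delay (W ⋆ X)) n    ≡⟨ delay-cong (delay-cong (⋆-comm W X)) n ⟩
  delay (delay (X ⋆ W)) n    ∎

delayBy : ℕ → (ℕ → ℚ) → ℕ → ℚ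
delayBy zero X = X
delayBy (suc a) X = delay (delayBy a X)

delayBy-cong : ∀ a {X Y} → (∀ i → X i ≡ Y i) → ∀ i → delayBy a X i ≡ delayBy a Y i
delayBy-cong zero h = h
delayBy-cong (suc a) h = delay-cong (delayBy-cong a h)

delayBy-below : ∀ a X i → i ℕ.< a → delayBy a X i ≡ 0ℚ
delayBy-below (suc a) X zero _ = refl
delayBy-below (suc a) X (suc i) (s≤s i<a) = delayBy-below a X i i<a

delayBy-at : ∀ a X j → delayBy a X (a ℕ.+ j) ≡ X j
delayBy-at zero X j = refl
delayBy-at (suc a) X j = delayBy-at a X j

delayBy-delay : ∀ a X i → delayBy a (delay X) i ≡ delay (delayBy a X) i
delayBy-delay zero X i = refl
delayBy-delay (suc a) X i = delay-cong (delayBy-delay a X) i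

⋆-delayByˡ : ∀ a X Z n → (delayBy a X ⋆ Z) n ≡ delayBy a (X ⋆ Z) n
⋆-delayByˡ zero X Z n = refl
⋆-delayByˡ (suc a) X Z n =
  trans (⋆-delayˡ (delayBy a X) Z n) (delay-cong (⋆-delayByˡ a X Z) n)

coeff-+ : ∀ p q i → coeff (p +ₚ q) i ≡ coeff p i ℚ.+ coeff q i
coeff-+ [] q i = sym (ℚP.+-identityˡ (coeff q i))
coeff-+ (a ∷ p) [] i = sym (ℚP.+-identityʳ (coeff (a ∷ p) i))
coeff-+ (a ∷ p) (b ∷ q) zero = refl
coeff-+ (a ∷ p) (b ∷ q) (suc i) = coeff-+ p q i

coeff-beyond : ∀ p i → length p ℕ.≤ i → coeff p i ≡ 0ℚ
coeff-beyond [] i _ = refl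
coeff-beyond (a ∷ p) (suc i) (s≤s h) = coeff-beyond p i h

coeff-constant : ∀ a i → coeff (a ∷ []) i ≡ a ℚ.* δ i
coeff-constant a zero = sym (ℚP.*-identityʳ a)
coeff-constant a (suc i) = sym (ℚP.*-zeroʳ a)

coeff-0∷ : ∀ p i → coeff (0ℚ ∷ p) i ≡ delay (coeff p) i
coeff-0∷ p zero = refl
coeff-0∷ p (suc i) = refl

taylor : Poly → ℕ → ℚ
taylor p = coeff (shift1 p)

-- Horner step: a + q·p(q) at q = 1 + t equals a + p(1+t) + t·p(1+t).
taylor-∷ : ∀ a p i → taylor (a ∷ p) i ≡ a ℚ.* δ i ℚ.+ (taylor p i ℚ.+ delay (taylor p) i)
taylor-∷ a p i = begin
  coeff ((a ∷ []) +ₚ (shift1 p +ₚ (0ℚ ∷ shift1 p))) i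
    ≡⟨ coeff-+ (a ∷ []) (shift1 p +ₚ (0ℚ ∷ shift1 p)) i ⟩
  coeff (a ∷ []) i ℚ.+ coeff (shift1 p +ₚ (0ℚ ∷ shift1 p)) i
    ≡⟨ cong₂ ℚ._+_ (coeff-constant a i)
        (trans (coeff-+ (shift1 p) (0ℚ ∷ shift1 p) i)
               (cong (taylor p i ℚ.+_) (coeff-0∷ (shift1 p) i))) ⟩
  a ℚ.* δ i ℚ.+ (taylor p i ℚ.+ delay (taylor p) i) ∎

delay-+ : ∀ X Y i → delay (λ j → X j ℚ.+ Y j) i ≡ delay X i ℚ.+ delay Y i
delay-+ X Y zero = refl
delay-+ X Y (suc i) = refl

delay-scale : ∀ a X i → delay (λ j → a ℚ.* X j) i ≡ a ℚ.* delay X i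
delay-scale a X zero = sym (ℚP.*-zeroʳ a)
delay-scale a X (suc i) = refl

taylor-+ : ∀ p q i → taylor (p +ₚ q) i ≡ taylor p i ℚ.+ taylor q i
taylor-+ [] q i = sym (ℚP.+-identityˡ (taylor q i))
taylor-+ (a ∷ p) [] i = sym (ℚP.+-identityʳ (taylor (a ∷ p) i))
taylor-+ (a ∷ p) (b ∷ q) i = begin
  taylor ((a ℚ.+ b) ∷ (p +ₚ q)) i
    ≡⟨ taylor-∷ (a ℚ.+ b) (p +ₚ q) i ⟩
  (a ℚ.+ b) ℚ.* δ i ℚ.+ (taylor (p +ₚ q) i ℚ.+ delay (taylor (p +ₚ q)) i)
    ≡⟨ cong₂ ℚ._+_ (ℚP.*-distribʳ-+ (δ i) a b)
         (cong₂ ℚ._+_ (taylor-+ p q i)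
                      (trans (delay-cong (taylor-+ p q) i) (delay-+ (taylor p) (taylor q) i))) ⟩
  (a ℚ.* δ i ℚ.+ b ℚ.* δ i) ℚ.+ ((P ℚ.+ Q) ℚ.+ (P' ℚ.+ Q'))
    ≡⟨ solve 6 (λ A B C D E F → (A :+ B) :+ ((C :+ D) :+ (E :+ F))
                               := (A :+ (C :+ E)) :+ (B :+ (D :+ F))) refl
         (a ℚ.* δ i) (b ℚ.* δ i) P Q P' Q' ⟩
  (a ℚ.* δ i ℚ.+ (P ℚ.+ P')) ℚ.+ (b ℚ.* δ i ℚ.+ (Q ℚ.+ Q'))
    ≡⟨ sym (cong₂ ℚ._+_ (taylor-∷ a p i) (taylor-∷ b q i)) ⟩
  taylor (a ∷ p) i ℚ.+ taylor (b ∷ q) i ∎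
  where
  P = taylor p i
  Q = taylor q i
  P' = delay (taylor p) i
  Q' = delay (taylor q) i

taylor-scale : ∀ a q i → taylor (scaleₚ a q) i ≡ a ℚ.* taylor q i
taylor-scale a [] i = sym (ℚP.*-zeroʳ a)
taylor-scale a (b ∷ q) i = begin
  taylor ((a ℚ.* b) ∷ scaleₚ a q) i
    ≡⟨ taylor-∷ (a ℚ.* b) (scaleₚ a q) i ⟩
  a ℚ.* b ℚ.* δ i ℚ.+ (taylor (scaleₚ a q) i ℚ.+ delay (taylor (scaleₚ a q)) i)
    ≡⟨ cong (a ℚ.* b ℚ.* δ i ℚ.+_)
         (cong₂ ℚ._+_ (taylor-scale a q i)
                      (trans (delay-cong (taylor-scale a q) i) (delay-scale a (taylor q) i))) ⟩
  a ℚ.* b ℚ.* δ i ℚ.+ (a ℚ.* taylor q i ℚ.+ a ℚ.* delay (taylor q) i)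
    ≡⟨ solve 5 (λ A B D E F → A :* B :* D :+ (A :* E :+ A :* F) := A :* (B :* D :+ (E :+ F))) refl
         a b (δ i) (taylor q i) (delay (taylor q) i) ⟩
  a ℚ.* (b ℚ.* δ i ℚ.+ (taylor q i ℚ.+ delay (taylor q) i))
    ≡⟨ cong (a ℚ.*_) (sym (taylor-∷ b q i)) ⟩
  a ℚ.* taylor (b ∷ q) i ∎

taylor-* : ∀ p q i → taylor (p *ₚ q) i ≡ (taylor p ⋆ taylor q) i
taylor-* [] q i = sym (⋆-zeroˡ (taylor q) i)
taylor-* (a ∷ p) q i = begin
  taylor (scaleₚ a q +ₚ (0ℚ ∷ (p *ₚ q))) i
    ≡⟨ taylor-+ (scaleₚ a q) (0ℚ ∷ (p *ₚ q)) i ⟩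
  taylor (scaleₚ a q) i ℚ.+ taylor (0ℚ ∷ (p *ₚ q)) i
    ≡⟨ cong₂ ℚ._+_ (taylor-scale a q i) (taylor-∷ 0ℚ (p *ₚ q) i) ⟩
  a ℚ.* Q i ℚ.+ (0ℚ ℚ.* δ i ℚ.+ (taylor (p *ₚ q) i ℚ.+ delay (taylor (p *ₚ q)) i))
    ≡⟨ cong (a ℚ.* Q i ℚ.+_)
        (trans (cong (ℚ._+ (taylor (p *ₚ q) i ℚ.+ delay (taylor (p *ₚ q)) i)) (ℚP.*-zeroˡ (δ i)))
        (trans (ℚP.+-identityˡ _)
               (cong₂ ℚ._+_ (taylor-* p q i) (delay-cong (taylor-* p q) i)))) ⟩
  a ℚ.* Q i ℚ.+ ((P ⋆ Q) i ℚ.+ delay (P ⋆ Q) i)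
    ≡⟨ sym (cong₂ ℚ._+_ (cong (a ℚ.*_) (⋆-identityˡ Q i))
                         (cong ((P ⋆ Q) i ℚ.+_) (⋆-delayˡ P Q i))) ⟩
  a ℚ.* (δ ⋆ Q) i ℚ.+ ((P ⋆ Q) i ℚ.+ (delay P ⋆ Q) i)
    ≡⟨ sym (cong₂ ℚ._+_ (⋆-scaleˡ a δ Q i) (⋆-distribʳ-+ P (delay P) Q i)) ⟩
  ((λ j → a ℚ.* δ j) ⋆ Q) i ℚ.+ ((λ j → P j ℚ.+ delay P j) ⋆ Q) i
    ≡⟨ sym (⋆-distribʳ-+ (λ j → a ℚ.* δ j) (λ j → P j ℚ.+ delay P j) Q i) ⟩
  ((λ j → a ℚ.* δ j ℚ.+ (P j ℚ.+ delay P j)) ⋆ Q) i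
    ≡⟨ sym (⋆-congˡ Q i (λ j _ → taylor-∷ a p j)) ⟩
  (taylor (a ∷ p) ⋆ Q) i ∎
  where
  P = taylor p
  Q = taylor q

taylor-oneₚ : ∀ i → taylor oneₚ i ≡ δ i
taylor-oneₚ zero = refl
taylor-oneₚ (suc i) = refl

-- binom j i = C(j, i), the coefficients of (1 + t)^j; Pascal's rule is the Horner step.
binom : ℕ → ℕ → ℚ
binom j = taylor (monoₚ j)

binom-pascal : ∀ j i → binom (suc j) i ≡ binom j i ℚ.+ delay (binom j) i
binom-pascal j i = trans (taylor-∷ 0ℚ (monoₚ j) i)
  (trans (cong (ℚ._+ (binom j i ℚ.+ delay (binom j) i)) (ℚP.*-zeroˡ (δ i)))
         (ℚP.+-identityˡ _))

binom-0 : ∀ j → binom j 0 ≡ 1ℚ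
binom-0 zero = refl
binom-0 (suc j) = trans (binom-pascal j 0) (cong (ℚ._+ 0ℚ) (binom-0 j))

-- 1 - (1+t)^j = t · Y_j(t), and Y_j(t) = -Σ_i C(j, i+1) t^i.
Y : ℕ → ℕ → ℚ
Y j i = taylor (oneMinusPow j) (suc i)

taylor-oneMinusPow : ∀ j i → taylor (oneMinusPow j) i ≡ taylor oneₚ i ℚ.+ (ℚ.- 1ℚ) ℚ.* binom j i
taylor-oneMinusPow j i = trans (taylor-+ oneₚ (scaleₚ (ℚ.- 1ℚ) (monoₚ j)) i)
                               (cong (taylor oneₚ i ℚ.+_) (taylor-scale (ℚ.- 1ℚ) (monoₚ j) i))

oneMinusPow-delay : ∀ j i → taylor (oneMinusPow j) i ≡ delay (Y j) i
oneMinusPow-delay j zero =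
  trans (taylor-oneMinusPow j 0) (cong (λ b → 1ℚ ℚ.+ (ℚ.- 1ℚ) ℚ.* b) (binom-0 j))
oneMinusPow-delay j (suc i) = refl

Y-binom : ∀ j i → Y j i ≡ (ℚ.- 1ℚ) ℚ.* binom j (suc i)
Y-binom j i = trans (taylor-oneMinusPow j (suc i)) (ℚP.+-identityˡ _)

E : ℕ → ℕ → ℚ
E zero = δ
E (suc k) = E k ⋆ (Y (suc k) ⋆ Y (suc k))

-- twice k = 2k, by a recursion matching that of denD.
twice : ℕ → ℕ
twice zero = zero
twice (suc k) = suc (suc (twice k))

twice≡2* : ∀ k → twice k ≡ 2 ℕ.* k
twice≡2* zero = refl
twice≡2* (suc k) = trans (cong (λ n → suc (suc n)) (twice≡2* k)) (sym (ℕP.*-suc 2 k))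

taylor-denD : ∀ k i → taylor (denD k) i ≡ delayBy (twice k) (E k) i
taylor-denD zero i = taylor-oneₚ i
taylor-denD (suc k) i = begin
  taylor (denD k *ₚ (A *ₚ A)) i
    ≡⟨ taylor-* (denD k) (A *ₚ A) i ⟩
  (taylor (denD k) ⋆ taylor (A *ₚ A)) i
    ≡⟨ ⋆-congˡ (taylor (A *ₚ A)) i (λ j _ → taylor-denD k j) ⟩
  (delayBy (twice k) (E k) ⋆ taylor (A *ₚ A)) i
    ≡⟨ ⋆-delayByˡ (twice k) (E k) (taylor (A *ₚ A)) i ⟩
  delayBy (twice k) (E k ⋆ taylor (A *ₚ A)) i
    ≡⟨ delayBy-cong (twice k) next i ⟩
  delayBy (twice k) (delay (delay (E (suc k)))) i
    ≡⟨ delayBy-delay (twice k) (delay (E (suc k))) i ⟩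
  delay (delayBy (twice k) (delay (E (suc k)))) i
    ≡⟨ delay-cong (delayBy-delay (twice k) (E (suc k))) i ⟩
  delayBy (twice (suc k)) (E (suc k)) i ∎
  where
  A = oneMinusPow (suc k)
  Yk = Y (suc k)
  next : ∀ n → (E k ⋆ taylor (A *ₚ A)) n ≡ delay (delay (E (suc k))) n
  next n = begin
    (E k ⋆ taylor (A *ₚ A)) n
      ≡⟨ ⋆-congʳ (E k) n (λ m _ → taylor-* A A m) ⟩
    (E k ⋆ (taylor A ⋆ taylor A)) n
      ≡⟨ ⋆-congʳ (E k) n (λ m _ →
           trans (⋆-congˡ (taylor A) m (λ r _ → oneMinusPow-delay (suc k) r))
                 (⋆-congʳ (delay Yk) m (λ r _ → oneMinusPow-delay (suc k) r))) ⟩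
    (E k ⋆ (delay Yk ⋆ delay Yk)) n
      ≡⟨ ⋆-congʳ (E k) n (λ m _ → delay-⋆-delay Yk m) ⟩
    (E k ⋆ delay (delay (Yk ⋆ Yk))) n
      ≡⟨ ⋆-delay²ʳ (E k) (Yk ⋆ Yk) n ⟩
    delay (delay (E (suc k))) n ∎

denD-below : ∀ k i → i ℕ.< twice k → taylor (denD k) i ≡ 0ℚ
denD-below k i h = trans (taylor-denD k i) (delayBy-below (twice k) (E k) i h)

denD-at : ∀ k j → taylor (denD k) (twice k ℕ.+ j) ≡ E k j
denD-at k j = trans (taylor-denD k (twice k ℕ.+ j)) (delayBy-at (twice k) (E k) j)

m⊖m+r≡0⊖r : ∀ m r → m ⊖ (m ℕ.+ r) ≡ 0 ⊖ r
m⊖m+r≡0⊖r m r = trans (cong (_⊖ (m ℕ.+ r)) (sym (ℕP.+-identityʳ m))) (ℤP.+-cancelˡ-⊖ m 0 r)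

0⊖n≡-n : ∀ n → 0 ⊖ n ≡ ℤ.- (+ n)
0⊖n≡-n zero = refl
0⊖n≡-n (suc n) = refl

m⊖n≡-[n∸m] : ∀ m n → m ℕ.≤ n → m ⊖ n ≡ ℤ.- (+ (n ∸ m))
m⊖n≡-[n∸m] m n m≤n = begin
  m ⊖ n                ≡⟨ cong (m ⊖_) (sym (ℕP.m+[n∸m]≡n m≤n)) ⟩
  m ⊖ (m ℕ.+ (n ∸ m))  ≡⟨ m⊖m+r≡0⊖r m (n ∸ m) ⟩
  0 ⊖ (n ∸ m)          ≡⟨ 0⊖n≡-n (n ∸ m) ⟩
  ℤ.- (+ (n ∸ m))      ∎

-[1+a]-i≡0⊖[1+a+i] : ∀ a i → -[1+ a ] ℤ.- (+ i) ≡ 0 ⊖ (suc a ℕ.+ i)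
-[1+a]-i≡0⊖[1+a+i] a zero = cong (0 ⊖_) (sym (ℕP.+-identityʳ (suc a)))
-[1+a]-i≡0⊖[1+a+i] a (suc i) = cong -[1+_] (sym (ℕP.+-suc a i))

VanishesBelow : ℕ → (ℤ → ℚ) → Set
VanishesBelow s c = ∀ b → s ℕ.< b → c (0 ⊖ b) ≡ 0ℚ

vanishesBelow-from-ℤ : ∀ s (c : ℤ → ℚ) → (∀ n → n ℤ.< ℤ.- (+ s) → c n ≡ 0ℚ) → VanishesBelow s c
vanishesBelow-from-ℤ s c h b s<b = h (0 ⊖ b) (lt s b s<b)
  where
  lt : ∀ s b → s ℕ.< b → (0 ⊖ b) ℤ.< ℤ.- (+ s)
  lt zero (suc b) _ = ℤ.-<+
  lt (suc s) (suc b) (s≤s s<b) = ℤ.-<- s<b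

vanishesBelow-to-ℤ : ∀ s (c : ℤ → ℚ) → VanishesBelow s c → ∀ n → n ℤ.< ℤ.- (+ s) → c n ≡ 0ℚ
vanishesBelow-to-ℤ s c h (+ a) lt = ⊥-elim (nonneg s a lt)
  where
  nonneg : ∀ s a → ¬ ((+ a) ℤ.< ℤ.- (+ s))
  nonneg zero a (ℤ.+<+ ())
  nonneg (suc s) a ()
vanishesBelow-to-ℤ s c h -[1+ a ] lt = h (suc a) (lt⇒ s a lt)
  where
  lt⇒ : ∀ s a → -[1+ a ] ℤ.< ℤ.- (+ s) → s ℕ.< suc a
  lt⇒ zero a _ = s≤s z≤n
  lt⇒ (suc s) a (ℤ.-<- h) = s≤s h

module ConvolutionEquation
  (d : ℕ → ℚ) (len : ℕ) (d-beyond : ∀ i → len ℕ.≤ i → d i ≡ 0ℚ)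
  (s : ℕ) (d-below : ∀ i → i ℕ.< s → d i ≡ 0ℚ)
  (w : ℚ) (w-inverse : w ℚ.* d s ≡ 1ℚ) where

  term : (ℤ → ℚ) → ℤ → ℕ → ℚ
  term c n i = d i ℚ.* c (n ℤ.- (+ i))

  term-beyond : ∀ c n i → len ℕ.≤ i → term c n i ≡ 0ℚ
  term-beyond c n i h =
    trans (cong (ℚ._* c (n ℤ.- (+ i))) (d-beyond i h)) (ℚP.*-zeroˡ (c (n ℤ.- (+ i))))

  term-below : ∀ c n i → i ℕ.< s → term c n i ≡ 0ℚ
  term-below c n i h =
    trans (cong (ℚ._* c (n ℤ.- (+ i))) (d-below i h)) (ℚP.*-zeroˡ (c (n ℤ.- (+ i))))

  term-negative : ∀ c a i → term c -[1+ a ] i ≡ d i ℚ.* c (0 ⊖ (suc a ℕ.+ i))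
  term-negative c a i = cong (λ n → d i ℚ.* c n) (-[1+a]-i≡0⊖[1+a+i] a i)

  lowest-cancel : ∀ x → d s ℚ.* x ≡ 0ℚ → x ≡ 0ℚ
  lowest-cancel x h = begin
    x                  ≡⟨ sym (ℚP.*-identityˡ x) ⟩
    1ℚ ℚ.* x           ≡⟨ cong (ℚ._* x) (sym w-inverse) ⟩
    w ℚ.* d s ℚ.* x    ≡⟨ ℚP.*-assoc w (d s) x ⟩
    w ℚ.* (d s ℚ.* x)  ≡⟨ cong (w ℚ.*_) h ⟩
    w ℚ.* 0ℚ           ≡⟨ ℚP.*-zeroʳ w ⟩
    0ℚ                 ∎

  equation-negative : ∀ c → VanishesBelow s c → ∀ a → Σ< len (term c -[1+ a ]) ≡ 0ℚ
  equation-negative c vanish a = Σ<-zero len (λ i _ → vanishing-term i)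
    where
    vanishing-term : ∀ i → term c -[1+ a ] i ≡ 0ℚ
    vanishing-term i with i ℕ.<? s
    ... | yes i<s = term-below c -[1+ a ] i i<s
    ... | no i≮s = trans (term-negative c a i)
      (trans (cong (d i ℚ.*_) (vanish (suc a ℕ.+ i)
                (ℕP.≤-trans (s≤s (ℕP.≮⇒≥ i≮s)) (s≤s (ℕP.m≤n+m i a)))))
             (ℚP.*-zeroʳ (d i)))

  -- Conversely a solution vanishing below -M whose equation has zero right-hand
  -- side at negative n vanishes below -s: by downward induction, the equation at
  -- n = -(b - s) isolates d s · c (-b).
  vanishes-below-order : ∀ c M → VanishesBelow M c → (∀ a → Σ< len (term c -[1+ a ]) ≡ 0ℚ) →
                         VanishesBelow s c
  vanishes-below-order c M vanishM eqs b s<b =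
    descend M b s<b (ℕP.+-monoˡ-≤ M (ℕP.≤-trans (s≤s z≤n) s<b))
    where
    descend : ∀ u b → s ℕ.< b → M ℕ.< b ℕ.+ u → c (0 ⊖ b) ≡ 0ℚ
    descend zero b s<b h = vanishM b (subst (M ℕ.<_) (ℕP.+-identityʳ b) h)
    descend (suc u) b s<b h with M ℕ.<? b ℕ.+ u
    ... | yes h' = descend u b s<b h'
    ... | no _ = lowest-cancel (c (0 ⊖ b)) isolated
      where
      a = b ∸ suc s
      b≡ : suc a ℕ.+ s ≡ b
      b≡ = trans (cong (ℕ._+ s) (sym (ℕP.+-∸-assoc 1 s<b))) (ℕP.m∸n+n≡m (ℕP.<⇒≤ s<b))
      above : ∀ i → suc s ℕ.≤ i → term c -[1+ a ] i ≡ 0ℚ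
      above i si = trans (term-negative c a i)
        (trans (cong (d i ℚ.*_) (descend u (suc a ℕ.+ i) (ℕP.<-trans s<b b<b') M<b'))
               (ℚP.*-zeroʳ (d i)))
        where
        b<b' : b ℕ.< suc a ℕ.+ i
        b<b' = subst (ℕ._< suc a ℕ.+ i) b≡ (ℕP.+-monoʳ-< (suc a) si)
        M<b' : M ℕ.< suc a ℕ.+ i ℕ.+ u
        M<b' = ℕP.≤-trans h (ℕP.≤-trans (ℕP.≤-reflexive (ℕP.+-suc b u)) (ℕP.+-monoˡ-≤ u b<b'))
      isolated : d s ℚ.* c (0 ⊖ b) ≡ 0ℚ
      isolated = begin
        d s ℚ.* c (0 ⊖ b)                ≡⟨ cong (λ n → d s ℚ.* c (0 ⊖ n)) (sym b≡) ⟩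
        d s ℚ.* c (0 ⊖ (suc a ℕ.+ s))    ≡⟨ sym (term-negative c a s) ⟩
        term c -[1+ a ] s                ≡⟨ sym (ℚP.+-identityˡ _) ⟩
        0ℚ ℚ.+ term c -[1+ a ] s         ≡⟨ cong (ℚ._+ term c -[1+ a ] s)
                                              (sym (Σ<-zero s (λ i → term-below c -[1+ a ] i))) ⟩
        Σ< (suc s) (term c -[1+ a ])     ≡⟨ Σ<-trunc (suc s) len (term c -[1+ a ]) above
                                              (term-beyond c -[1+ a ]) ⟩
        Σ< len (term c -[1+ a ])         ≡⟨ eqs a ⟩
        0ℚ                               ∎

  e : ℕ → ℚ
  e j = d (s ℕ.+ j)

  w-inverse₀ : w ℚ.* e 0 ≡ 1ℚ
  w-inverse₀ = trans (cong (λ i → w ℚ.* d i) (ℕP.+-identityʳ s)) w-inverse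

  equation-nonneg : ∀ c → VanishesBelow s c → ∀ m →
    Σ< len (term c (+ m)) ≡ Σ< (suc m) (λ j → e j ℚ.* c ((m ∸ j) ⊖ s))
  equation-nonneg c vanish m = begin
    Σ< len (term c (+ m))
      ≡⟨ Σ<-trunc len (s ℕ.+ suc m) (term c (+ m)) (term-beyond c (+ m)) above ⟩
    Σ< (s ℕ.+ suc m) (term c (+ m))
      ≡⟨ Σ<-split s (suc m) (term c (+ m)) ⟩
    Σ< s (term c (+ m)) ℚ.+ Σ< (suc m) (λ j → term c (+ m) (s ℕ.+ j))
      ≡⟨ cong₂ ℚ._+_ (Σ<-zero s (term-below c (+ m)))
           (Σ<-ext (suc m) (λ j j≤m → cong (λ n → e j ℚ.* c n) (index j (ℕP.≤-pred j≤m)))) ⟩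
    0ℚ ℚ.+ Σ< (suc m) (λ j → e j ℚ.* c ((m ∸ j) ⊖ s))
      ≡⟨ ℚP.+-identityˡ _ ⟩
    Σ< (suc m) (λ j → e j ℚ.* c ((m ∸ j) ⊖ s)) ∎
    where
    index : ∀ j → j ℕ.≤ m → (+ m) ℤ.- (+ (s ℕ.+ j)) ≡ (m ∸ j) ⊖ s
    index j j≤m = trans (ℤP.[+m]-[+n]≡m⊖n m (s ℕ.+ j))
      (trans (cong₂ _⊖_ (sym (ℕP.m+[n∸m]≡n j≤m)) (ℕP.+-comm s j))
             (ℤP.+-cancelˡ-⊖ j (m ∸ j) s))
    above : ∀ i → s ℕ.+ suc m ℕ.≤ i → term c (+ m) i ≡ 0ℚ
    above i h = trans (cong (λ n → d i ℚ.* c n) m-i≡)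
      (trans (cong (d i ℚ.*_) (vanish (i ∸ m) s<i∸m)) (ℚP.*-zeroʳ (d i)))
      where
      s+m<i : s ℕ.+ m ℕ.< i
      s+m<i = ℕP.≤-trans (ℕP.≤-reflexive (sym (ℕP.+-suc s m))) h
      m≤i : m ℕ.≤ i
      m≤i = ℕP.≤-trans (ℕP.m≤n+m m s) (ℕP.<⇒≤ s+m<i)
      m-i≡ : (+ m) ℤ.- (+ i) ≡ 0 ⊖ (i ∸ m)
      m-i≡ = trans (ℤP.[+m]-[+n]≡m⊖n m i)
                   (trans (cong (m ⊖_) (sym (ℕP.m+[n∸m]≡n m≤i))) (m⊖m+r≡0⊖r m (i ∸ m)))
      s<i∸m : s ℕ.< i ∸ m
      s<i∸m = ℕP.+-cancelʳ-< m s (i ∸ m) (subst (s ℕ.+ m ℕ.<_) (sym (ℕP.m∸n+n≡m m≤i)) s+m<i)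

  module Solution (N : ℤ → ℚ) (N-negative : ∀ a → N -[1+ a ] ≡ 0ℚ) (c : ℤ → ℚ)
                  (bounded : ∃ λ (M : ℕ) → ∀ (n : ℤ) → n ℤ.< ℤ.- (+ M) → c n ≡ 0ℚ)
                  (solves : ∀ n → Σ< len (term c n) ≡ N n) where

    vanishes : VanishesBelow s c
    vanishes = vanishes-below-order c (proj₁ bounded)
      (vanishesBelow-from-ℤ (proj₁ bounded) c (proj₂ bounded))
      (λ a → trans (solves -[1+ a ]) (N-negative a))

    triangular : ∀ m → Σ< (suc m) (λ j → e j ℚ.* c ((m ∸ j) ⊖ s)) ≡ N (+ m)
    triangular m = trans (sym (equation-nonneg c vanishes m)) (solves (+ m))

  module Construction (N : ℤ → ℚ) (N-negative : ∀ a → N -[1+ a ] ≡ 0ℚ) where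

    -- approx m i: the i-th value as fixed at stage m (stable once i ≤ m).
    approx : ℕ → ℕ → ℚ
    approx zero i = w ℚ.* N (+ 0)
    approx (suc m) i with i ℕ.≤? m
    ... | yes _ = approx m i
    ... | no _ = w ℚ.* (N (+ suc m) ℚ.- Σ< (suc m) (λ j → e (suc j) ℚ.* approx m (m ∸ j)))

    f : ℕ → ℚ
    f m = approx m m

    approx-step : ∀ m i → i ℕ.≤ m → approx (suc m) i ≡ approx m i
    approx-step m i h with i ℕ.≤? m
    ... | yes _ = refl
    ... | no i≰m = ⊥-elim (i≰m h)

    approx-stable : ∀ i r → approx (i ℕ.+ r) i ≡ f i
    approx-stable i zero = cong (λ m → approx m i) (ℕP.+-identityʳ i)
    approx-stable i (suc r) = trans (cong (λ m → approx m i) (ℕP.+-suc i r))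
      (trans (approx-step (i ℕ.+ r) i (ℕP.m≤m+n i r)) (approx-stable i r))

    approx≡f : ∀ i m → i ℕ.≤ m → approx m i ≡ f i
    approx≡f i m h = trans (cong (λ n → approx n i) (sym (ℕP.m+[n∸m]≡n h))) (approx-stable i (m ∸ i))

    f-suc : ∀ m →
      f (suc m) ≡ w ℚ.* (N (+ suc m) ℚ.- Σ< (suc m) (λ j → e (suc j) ℚ.* approx m (m ∸ j)))
    f-suc m with suc m ℕ.≤? m
    ... | yes h = ⊥-elim (ℕP.1+n≰n h)
    ... | no _ = refl

    solve-for : ∀ n x → e 0 ℚ.* (w ℚ.* (n ℚ.- x)) ℚ.+ x ≡ n
    solve-for n x = begin
      e 0 ℚ.* (w ℚ.* (n ℚ.- x)) ℚ.+ x
        ≡⟨ solve 4 (λ E W A B → E :* (W :* (A :- B)) :+ B := (W :* E) :* (A :- B) :+ B) refl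
             (e 0) w n x ⟩
      (w ℚ.* e 0) ℚ.* (n ℚ.- x) ℚ.+ x
        ≡⟨ cong (λ a → a ℚ.* (n ℚ.- x) ℚ.+ x) w-inverse₀ ⟩
      1ℚ ℚ.* (n ℚ.- x) ℚ.+ x
        ≡⟨ solve 2 (λ A B → con 1ℚ :* (A :- B) :+ B := A) refl n x ⟩
      n ∎

    f-triangular : ∀ m → Σ< (suc m) (λ j → e j ℚ.* f (m ∸ j)) ≡ N (+ m)
    f-triangular zero = trans (ℚP.+-identityˡ _) (begin
      e 0 ℚ.* (w ℚ.* N₀)   ≡⟨ solve 3 (λ E W A → E :* (W :* A) := (W :* E) :* A) refl (e 0) w N₀ ⟩
      (w ℚ.* e 0) ℚ.* N₀   ≡⟨ cong (ℚ._* N₀) w-inverse₀ ⟩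
      1ℚ ℚ.* N₀            ≡⟨ ℚP.*-identityˡ N₀ ⟩
      N₀                   ∎)
      where
      N₀ = N (+ 0)
    f-triangular (suc m) = begin
      Σ< (suc (suc m)) (λ j → e j ℚ.* f (suc m ∸ j))
        ≡⟨ Σ<-head (suc m) (λ j → e j ℚ.* f (suc m ∸ j)) ⟩
      e 0 ℚ.* f (suc m) ℚ.+ Σ< (suc m) (λ j → e (suc j) ℚ.* f (m ∸ j))
        ≡⟨ cong₂ ℚ._+_ (cong (e 0 ℚ.*_) (f-suc m))
             (Σ<-ext (suc m) (λ j _ →
                cong (e (suc j) ℚ.*_) (sym (approx≡f (m ∸ j) m (ℕP.m∸n≤m m j))))) ⟩
      e 0 ℚ.* (w ℚ.* (N (+ suc m) ℚ.- rest)) ℚ.+ rest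
        ≡⟨ solve-for (N (+ suc m)) rest ⟩
      N (+ suc m) ∎
      where
      rest = Σ< (suc m) (λ j → e (suc j) ℚ.* approx m (m ∸ j))

    f↑ : ℤ → ℚ
    f↑ (+ m) = f m
    f↑ -[1+ _ ] = 0ℚ

    c : ℤ → ℚ
    c n = f↑ (n ℤ.+ (+ s))

    c-at : ∀ m → c (m ⊖ s) ≡ f m
    c-at m = cong f↑ (trans (ℤP.distribˡ-⊖-+-pos s m s)
                     (trans (ℤP.⊖-≥ (ℕP.m≤n+m s m)) (cong +_ (ℕP.m+n∸n≡m m s))))

    c-vanishes : VanishesBelow s c
    c-vanishes b s<b = cong f↑ (trans (ℤP.distribˡ-⊖-+-pos s 0 b)
                               (trans (cong (s ⊖_) (sym b≡)) (m⊖m+r≡0⊖r s (suc r))))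
      where
      r = b ∸ suc s
      b≡ : s ℕ.+ suc r ≡ b
      b≡ = trans (ℕP.+-suc s r) (ℕP.m+[n∸m]≡n s<b)

    c-solves : ∀ n → Σ< len (term c n) ≡ N n
    c-solves (+ m) = begin
      Σ< len (term c (+ m))                          ≡⟨ equation-nonneg c c-vanishes m ⟩
      Σ< (suc m) (λ j → e j ℚ.* c ((m ∸ j) ⊖ s))     ≡⟨ Σ<-ext (suc m) (λ j _ → cong (e j ℚ.*_) (c-at (m ∸ j))) ⟩
      Σ< (suc m) (λ j → e j ℚ.* f (m ∸ j))           ≡⟨ f-triangular m ⟩
      N (+ m)                                        ∎
    c-solves -[1+ a ] = trans (equation-negative c c-vanishes a) (sym (N-negative a))

triangular-unique : ∀ m (a X X' : ℕ → ℚ) → a 0 ≡ 1ℚ → (∀ i → i ℕ.< m → X i ≡ X' i) →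
  Σ< (suc m) (λ j → a j ℚ.* X (m ∸ j)) ≡ Σ< (suc m) (λ j → a j ℚ.* X' (m ∸ j)) → X m ≡ X' m
triangular-unique m a X X' a₀≡1 earlier same = begin
  X m             ≡⟨ sym (ℚP.*-identityˡ (X m)) ⟩
  1ℚ ℚ.* X m      ≡⟨ cong (ℚ._* X m) (sym a₀≡1) ⟩
  a 0 ℚ.* X m     ≡⟨ ∙-cancelʳ (rest X') (a 0 ℚ.* X m) (a 0 ℚ.* X' m) heads ⟩
  a 0 ℚ.* X' m    ≡⟨ cong (ℚ._* X' m) a₀≡1 ⟩
  1ℚ ℚ.* X' m     ≡⟨ ℚP.*-identityˡ (X' m) ⟩
  X' m            ∎
  where
  rest : (ℕ → ℚ) → ℚ
  rest Z = Σ< m (λ j → a (suc j) ℚ.* Z (m ∸ suc j))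
  rests : rest X ≡ rest X'
  rests = Σ<-ext m (λ j j<m → cong (a (suc j) ℚ.*_)
    (earlier (m ∸ suc j) (ℕP.∸-monoʳ-< {m} {suc j} {0} (s≤s z≤n) j<m)))
  heads : a 0 ℚ.* X m ℚ.+ rest X' ≡ a 0 ℚ.* X' m ℚ.+ rest X'
  heads = begin
    a 0 ℚ.* X m ℚ.+ rest X'                  ≡⟨ cong (a 0 ℚ.* X m ℚ.+_) (sym rests) ⟩
    a 0 ℚ.* X m ℚ.+ rest X                   ≡⟨ sym (Σ<-head m (λ j → a j ℚ.* X (m ∸ j))) ⟩
    Σ< (suc m) (λ j → a j ℚ.* X (m ∸ j))     ≡⟨ same ⟩
    Σ< (suc m) (λ j → a j ℚ.* X' (m ∸ j))    ≡⟨ Σ<-head m (λ j → a j ℚ.* X' (m ∸ j)) ⟩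
    a 0 ℚ.* X' m ℚ.+ rest X'                 ∎

fromℤ : ℤ → ℚ
fromℤ i = i ℚ./ 1

fromℕ : ℕ → ℚ
fromℕ n = fromℤ (+ n)

fromℚᵘ-+ : ∀ p q → fromℚᵘ (p ℚᵘ.+ q) ≡ fromℚᵘ p ℚ.+ fromℚᵘ q
fromℚᵘ-+ p q = ℚP.toℚᵘ-injective (ℚᵘP.≃-trans (ℚP.toℚᵘ-fromℚᵘ (p ℚᵘ.+ q))
  (ℚᵘP.≃-sym (ℚᵘP.≃-trans (ℚP.toℚᵘ-homo-+ (fromℚᵘ p) (fromℚᵘ q))
                          (ℚᵘP.+-cong (ℚP.toℚᵘ-fromℚᵘ p) (ℚP.toℚᵘ-fromℚᵘ q)))))

fromℚᵘ-* : ∀ p q → fromℚᵘ (p ℚᵘ.* q) ≡ fromℚᵘ p ℚ.* fromℚᵘ q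
fromℚᵘ-* p q = ℚP.toℚᵘ-injective (ℚᵘP.≃-trans (ℚP.toℚᵘ-fromℚᵘ (p ℚᵘ.* q))
  (ℚᵘP.≃-sym (ℚᵘP.≃-trans (ℚP.toℚᵘ-homo-* (fromℚᵘ p) (fromℚᵘ q))
                          (ℚᵘP.*-cong (ℚP.toℚᵘ-fromℚᵘ p) (ℚP.toℚᵘ-fromℚᵘ q)))))

fromℚᵘ-neg : ∀ p → fromℚᵘ (ℚᵘ.- p) ≡ ℚ.- fromℚᵘ p
fromℚᵘ-neg p = ℚP.toℚᵘ-injective (ℚᵘP.≃-trans (ℚP.toℚᵘ-fromℚᵘ (ℚᵘ.- p))
  (ℚᵘP.≃-sym (ℚᵘP.≃-trans (ℚP.toℚᵘ-homo‿- (fromℚᵘ p)) (ℚᵘP.-‿cong (ℚP.toℚᵘ-fromℚᵘ p)))))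

fromℤ-+ : ∀ i j → fromℤ (i ℤ.+ j) ≡ fromℤ i ℚ.+ fromℤ j
fromℤ-+ i j = trans (ℚP.fromℚᵘ-cong {mkℚᵘ (i ℤ.+ j) 0} {mkℚᵘ i 0 ℚᵘ.+ mkℚᵘ j 0} (*≡* cross))
                    (fromℚᵘ-+ (mkℚᵘ i 0) (mkℚᵘ j 0))
  where
  open ℤSolver.+-*-Solver renaming (solve to solveℤ; _:+_ to _⊕_; _:*_ to _⊗_; con to conℤ; _:=_ to _≐_)
  cross : (i ℤ.+ j) ℤ.* (+ 1) ≡ (i ℤ.* (+ 1) ℤ.+ j ℤ.* (+ 1)) ℤ.* (+ 1)
  cross = solveℤ 2 (λ a b → (a ⊕ b) ⊗ conℤ (+ 1) ≐ (a ⊗ conℤ (+ 1) ⊕ b ⊗ conℤ (+ 1)) ⊗ conℤ (+ 1))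
                 refl i j

fromℤ-neg : ∀ i → fromℤ (ℤ.- i) ≡ ℚ.- fromℤ i
fromℤ-neg i = fromℚᵘ-neg (mkℚᵘ i 0)

fromℕ-+ : ∀ a b → fromℕ (a ℕ.+ b) ≡ fromℕ a ℚ.+ fromℕ b
fromℕ-+ a b = fromℤ-+ (+ a) (+ b)

fromℕ-suc : ∀ n → fromℕ (suc n) ≡ fromℕ n ℚ.+ 1ℚ
fromℕ-suc n = trans (cong fromℤ (ℤP.+-comm (+ 1) (+ n))) (fromℕ-+ n 1)

fromℕ-* : ∀ a b → fromℕ (a ℕ.* b) ≡ fromℕ a ℚ.* fromℕ b
fromℕ-* zero b = sym (ℚP.*-zeroˡ (fromℕ b))
fromℕ-* (suc a) b = begin
  fromℕ (b ℕ.+ a ℕ.* b)               ≡⟨ fromℕ-+ b (a ℕ.* b) ⟩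
  fromℕ b ℚ.+ fromℕ (a ℕ.* b)         ≡⟨ cong (fromℕ b ℚ.+_) (fromℕ-* a b) ⟩
  fromℕ b ℚ.+ fromℕ a ℚ.* fromℕ b     ≡⟨ solve 2 (λ B A → B :+ A :* B := (A :+ con 1ℚ) :* B) refl
                                           (fromℕ b) (fromℕ a) ⟩
  (fromℕ a ℚ.+ 1ℚ) ℚ.* fromℕ b        ≡⟨ cong (ℚ._* fromℕ b) (sym (fromℕ-suc a)) ⟩
  fromℕ (suc a) ℚ.* fromℕ b           ∎

pow : ℚ → ℕ → ℚ
pow x zero = 1ℚ
pow x (suc n) = x ℚ.* pow x n

fromℕ-^ : ∀ k n → fromℕ (k ℕ.^ n) ≡ pow (fromℕ k) n
fromℕ-^ k zero = refl
fromℕ-^ k (suc n) = trans (fromℕ-* k (k ℕ.^ n)) (cong (fromℕ k ℚ.*_) (fromℕ-^ k n))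

/-inverse : ∀ i d .{{_ : NonZero d}} → (i ℚ./ d) ℚ.* fromℕ d ≡ fromℤ i
/-inverse i (suc d) = trans (sym (fromℚᵘ-* (mkℚᵘ i d) (mkℚᵘ (+ suc d) 0)))
  (ℚP.fromℚᵘ-cong {mkℚᵘ i d ℚᵘ.* mkℚᵘ (+ suc d) 0} {mkℚᵘ i 0} (*≡* cross))
  where
  cross : (i ℤ.* (+ suc d)) ℤ.* (+ 1) ≡ i ℤ.* (+ suc (d ℕ.* 1))
  cross = trans (ℤP.*-identityʳ _) (cong (λ n → i ℤ.* (+ suc n)) (sym (ℕP.*-identityʳ d)))

/-as-* : ∀ i d .{{_ : NonZero d}} (d⁻¹ : ℚ) → fromℕ d ℚ.* d⁻¹ ≡ 1ℚ → i ℚ./ d ≡ fromℤ i ℚ.* d⁻¹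
/-as-* i d d⁻¹ h = begin
  i ℚ./ d                              ≡⟨ sym (ℚP.*-identityʳ _) ⟩
  (i ℚ./ d) ℚ.* 1ℚ                     ≡⟨ cong ((i ℚ./ d) ℚ.*_) (sym h) ⟩
  (i ℚ./ d) ℚ.* (fromℕ d ℚ.* d⁻¹)      ≡⟨ sym (ℚP.*-assoc (i ℚ./ d) (fromℕ d) d⁻¹) ⟩
  (i ℚ./ d) ℚ.* fromℕ d ℚ.* d⁻¹        ≡⟨ cong (ℚ._* d⁻¹) (/-inverse i d) ⟩
  fromℤ i ℚ.* d⁻¹                      ∎

fact : ℕ → ℚ
fact n = fromℕ (n !)

inv!-fact : ∀ n → inv! n ℚ.* fact n ≡ 1ℚ
inv!-fact n = /-inverse (+ 1) (n !) {{ℕP._!≢0 n}}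

fact-suc : ∀ n → fact (suc n) ≡ fromℕ (suc n) ℚ.* fact n
fact-suc n = fromℕ-* (suc n) (n !)

inv!-pred : ∀ n → inv! n ≡ fromℕ (suc n) ℚ.* inv! (suc n)
inv!-pred n = begin
  a                                           ≡⟨ sym (ℚP.*-identityʳ a) ⟩
  a ℚ.* 1ℚ                                    ≡⟨ cong (a ℚ.*_) (sym (inv!-fact (suc n))) ⟩
  a ℚ.* (b ℚ.* fact (suc n))                  ≡⟨ cong (λ x → a ℚ.* (b ℚ.* x)) (fact-suc n) ⟩
  a ℚ.* (b ℚ.* (fromℕ (suc n) ℚ.* fact n))    ≡⟨ solve 4 (λ A B X G → A :* (B :* (X :* G))
                                                    := (A :* G) :* (X :* B)) refl a b (fromℕ (suc n)) (fact n) ⟩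
  (a ℚ.* fact n) ℚ.* (fromℕ (suc n) ℚ.* b)    ≡⟨ cong (ℚ._* (fromℕ (suc n) ℚ.* b)) (inv!-fact n) ⟩
  1ℚ ℚ.* (fromℕ (suc n) ℚ.* b)                ≡⟨ ℚP.*-identityˡ _ ⟩
  fromℕ (suc n) ℚ.* b                         ∎
  where
  a = inv! n
  b = inv! (suc n)

-- Closed forms, as polynomials in k, of the first coefficients.  They are given as
-- syntactic polynomials so that identities between them follow by normalisation.
module Formulas {n : ℕ} where

  frac : ℤ → (d : ℕ) → .{{_ : NonZero d}} → Polynomial n
  frac i d = con (i ℚ./ d)

  binomP : ℕ → Polynomial n → Polynomial n
  binomP 0 x = con 1ℚ
  binomP 1 x = x
  binomP 2 x = frac (+ 1) 2 :* (x :* x :- x)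
  binomP 3 x = frac (+ 1) 6 :* (x :* x :* x :- frac (+ 3) 1 :* x :* x :+ frac (+ 2) 1 :* x)
  binomP 4 x = frac (+ 1) 24 :* (x :* x :* x :* x :- frac (+ 6) 1 :* x :* x :* x
                                 :+ frac (+ 11) 1 :* x :* x :- frac (+ 6) 1 :* x)
  binomP _ x = con 0ℚ

  YP : Polynomial n → ℕ → Polynomial n
  YP x b = con (ℚ.- 1ℚ) :* binomP (suc b) x

  -- denP a y = E_y[a] / (y!)²  for a ≤ 3.
  denP : ℕ → Polynomial n → Polynomial n
  denP 0 y = con 1ℚ
  denP 1 y = frac (+ 1) 2 :* (y :* y :- y)
  denP 2 y = frac (+ 13) 72 :* y :- frac (+ 1) 12 :* y :* y :- frac (+ 2) 9 :* y :* y :* y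
             :+ frac (+ 1) 8 :* y :* y :* y :* y
  denP 3 y = frac -[1+ 6 ] 72 :* y :+ frac (+ 5) 144 :* y :* y :+ frac (+ 7) 48 :* y :* y :* y
             :- frac (+ 1) 18 :* y :* y :* y :* y :- frac (+ 7) 144 :* y :* y :* y :* y :* y
             :+ frac (+ 1) 48 :* y :* y :* y :* y :* y :* y
  denP _ y = con 0ℚ

  -- quotP m y = (y!)² f(m), the normalised coefficients of (1+t)^{y²} / E_y(t).
  quotP : ℕ → Polynomial n → Polynomial n
  quotP 0 y = con 1ℚ
  quotP 1 y = frac (+ 1) 2 :* (y :* y :+ y)
  quotP 2 y = frac (+ 1) 72 :* ((frac (+ 9) 1 :* y :* y :+ frac (+ 25) 1 :* y :+ frac (+ 13) 1)
                                :* (y :- con 1ℚ) :* y)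
  quotP 3 y = frac (+ 1) 144 :* ((frac (+ 3) 1 :* y :* y :* y :* y :+ frac (+ 10) 1 :* y :* y :* y
                                  :- frac (+ 4) 1 :* y :* y :- frac (+ 31) 1 :* y :- frac (+ 14) 1)
                                 :* (y :- con 1ℚ) :* y)
  quotP _ y = con 0ℚ

  sumP : ℕ → (ℕ → Polynomial n) → Polynomial n
  sumP zero F = con 0ℚ
  sumP (suc m) F = sumP m F :+ F m

  _⋆P_ : (ℕ → Polynomial n) → (ℕ → Polynomial n) → ℕ → Polynomial n
  (X ⋆P Z) m = sumP (suc m) (λ i → X i :* Z (m ∸ i))

  powP : Polynomial n → ℕ → Polynomial n
  powP x zero = con 1ℚ
  powP x (suc m) = x :* powP x m

open Formulas

x₀ : Polynomial 1
x₀ = var fzero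

eval₁ : Polynomial 1 → ℚ → ℚ
eval₁ p x = ⟦ p ⟧ (x Vec.∷ Vec.[])

binomQ denQ quotQ : ℕ → ℚ → ℚ
binomQ i = eval₁ (binomP i x₀)
denQ a = eval₁ (denP a x₀)
quotQ m = eval₁ (quotP m x₀)

YQ : ℕ → ℚ → ℚ
YQ b = eval₁ (YP x₀ b)

binomQ-pascal : ∀ i → i ℕ.< 4 → ∀ x → binomQ (suc i) x ℚ.+ binomQ i x ≡ binomQ (suc i) (x ℚ.+ 1ℚ)
binomQ-pascal 0 _ = solve 1 (λ x → binomP 1 x :+ binomP 0 x := binomP 1 (x :+ con 1ℚ)) refl
binomQ-pascal 1 _ = solve 1 (λ x → binomP 2 x :+ binomP 1 x := binomP 2 (x :+ con 1ℚ)) refl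
binomQ-pascal 2 _ = solve 1 (λ x → binomP 3 x :+ binomP 2 x := binomP 3 (x :+ con 1ℚ)) refl
binomQ-pascal 3 _ = solve 1 (λ x → binomP 4 x :+ binomP 3 x := binomP 4 (x :+ con 1ℚ)) refl
binomQ-pascal (suc (suc (suc (suc _)))) (s≤s (s≤s (s≤s (s≤s ()))))

binom-closed : ∀ j i → i ℕ.≤ 4 → binom j i ≡ binomQ i (fromℕ j)
binom-closed j 0 _ = binom-0 j
binom-closed zero 1 _ = refl
binom-closed zero 2 _ = refl
binom-closed zero 3 _ = refl
binom-closed zero 4 _ = refl
binom-closed zero (suc (suc (suc (suc (suc _))))) (s≤s (s≤s (s≤s (s≤s ()))))
binom-closed (suc j) (suc i) i<4 = begin
  binom (suc j) (suc i)                              ≡⟨ binom-pascal j (suc i) ⟩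
  binom j (suc i) ℚ.+ binom j i                      ≡⟨ cong₂ ℚ._+_ (binom-closed j (suc i) i<4)
                                                          (binom-closed j i (ℕP.<⇒≤ i<4)) ⟩
  binomQ (suc i) (fromℕ j) ℚ.+ binomQ i (fromℕ j)    ≡⟨ binomQ-pascal i i<4 (fromℕ j) ⟩
  binomQ (suc i) (fromℕ j ℚ.+ 1ℚ)                    ≡⟨ cong (binomQ (suc i)) (sym (fromℕ-suc j)) ⟩
  binomQ (suc i) (fromℕ (suc j))                     ∎

Y-closed : ∀ j b → b ℕ.≤ 3 → Y j b ≡ YQ b (fromℕ j)
Y-closed j b b≤3 = trans (Y-binom j b) (cong (ℚ.- 1ℚ ℚ.*_) (binom-closed j (suc b) (s≤s b≤3)))

-- The recursion E_{k+1} = E_k · Y_{k+1}² for the normalised closed forms: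
-- (P(y) ⋆ Y_{y+1} ⋆ Y_{y+1})[a] = (y+1)² P_a(y+1).
denQ-step : ∀ a → a ℕ.≤ 3 → ∀ y →
  ((λ a' → denQ a' y) ⋆ ((λ b → YQ b (y ℚ.+ 1ℚ)) ⋆ (λ b → YQ b (y ℚ.+ 1ℚ)))) a
  ≡ (y ℚ.+ 1ℚ) ℚ.* (y ℚ.+ 1ℚ) ℚ.* denQ a (y ℚ.+ 1ℚ)
denQ-step 0 _ = solve 1 (λ y → ((λ a' → denP a' y) ⋆P (YP (y :+ con 1ℚ) ⋆P YP (y :+ con 1ℚ))) 0
                               := (y :+ con 1ℚ) :* (y :+ con 1ℚ) :* denP 0 (y :+ con 1ℚ)) refl
denQ-step 1 _ = solve 1 (λ y → ((λ a' → denP a' y) ⋆P (YP (y :+ con 1ℚ) ⋆P YP (y :+ con 1ℚ))) 1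
                               := (y :+ con 1ℚ) :* (y :+ con 1ℚ) :* denP 1 (y :+ con 1ℚ)) refl
denQ-step 2 _ = solve 1 (λ y → ((λ a' → denP a' y) ⋆P (YP (y :+ con 1ℚ) ⋆P YP (y :+ con 1ℚ))) 2
                               := (y :+ con 1ℚ) :* (y :+ con 1ℚ) :* denP 2 (y :+ con 1ℚ)) refl
denQ-step 3 _ = solve 1 (λ y → ((λ a' → denP a' y) ⋆P (YP (y :+ con 1ℚ) ⋆P YP (y :+ con 1ℚ))) 3
                               := (y :+ con 1ℚ) :* (y :+ con 1ℚ) :* denP 3 (y :+ con 1ℚ)) refl
denQ-step (suc (suc (suc (suc _)))) (s≤s (s≤s (s≤s ())))

E-closed : ∀ k a → a ℕ.≤ 3 → E k a ≡ fact k ℚ.* fact k ℚ.* denQ a (fromℕ k)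
E-closed zero 0 _ = refl
E-closed zero 1 _ = refl
E-closed zero 2 _ = refl
E-closed zero 3 _ = refl
E-closed (suc k) a a≤3 = begin
  (E k ⋆ (Yk ⋆ Yk)) a
    ≡⟨ ⋆-congˡ (Yk ⋆ Yk) a (λ a' a'≤a → E-closed k a' (ℕP.≤-trans a'≤a a≤3)) ⟩
  ((λ a' → G ℚ.* G ℚ.* P a') ⋆ (Yk ⋆ Yk)) a
    ≡⟨ ⋆-scaleˡ (G ℚ.* G) P (Yk ⋆ Yk) a ⟩
  G ℚ.* G ℚ.* (P ⋆ (Yk ⋆ Yk)) a
    ≡⟨ cong (G ℚ.* G ℚ.*_) (⋆-congʳ P a (λ b b≤a →
         trans (⋆-congˡ Yk b (λ c c≤b → Y-closed (suc k) c (bound c≤b b≤a)))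
               (⋆-congʳ (Yat (fromℕ (suc k))) b (λ c c≤b → Y-closed (suc k) c (bound c≤b b≤a))))) ⟩
  G ℚ.* G ℚ.* (P ⋆ (Yat (fromℕ (suc k)) ⋆ Yat (fromℕ (suc k)))) a
    ≡⟨ cong (λ x → G ℚ.* G ℚ.* (P ⋆ (Yat x ⋆ Yat x)) a) (fromℕ-suc k) ⟩
  G ℚ.* G ℚ.* (P ⋆ (Yat (y ℚ.+ 1ℚ) ⋆ Yat (y ℚ.+ 1ℚ))) a
    ≡⟨ cong (G ℚ.* G ℚ.*_) (denQ-step a a≤3 y) ⟩
  G ℚ.* G ℚ.* ((y ℚ.+ 1ℚ) ℚ.* (y ℚ.+ 1ℚ) ℚ.* denQ a (y ℚ.+ 1ℚ))
    ≡⟨ solve 3 (λ G Y P → G :* G :* (Y :* Y :* P) := (Y :* G) :* (Y :* G) :* P) refl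
         G (y ℚ.+ 1ℚ) (denQ a (y ℚ.+ 1ℚ)) ⟩
  ((y ℚ.+ 1ℚ) ℚ.* G) ℚ.* ((y ℚ.+ 1ℚ) ℚ.* G) ℚ.* denQ a (y ℚ.+ 1ℚ)
    ≡⟨ sym (cong₂ (λ g x → g ℚ.* g ℚ.* denQ a x) fact-suc' (fromℕ-suc k)) ⟩
  fact (suc k) ℚ.* fact (suc k) ℚ.* denQ a (fromℕ (suc k)) ∎
  where
  G = fact k
  y = fromℕ k
  Yk = Y (suc k)
  P : ℕ → ℚ
  P a' = denQ a' y
  Yat : ℚ → ℕ → ℚ
  Yat x b = YQ b x
  bound : ∀ {c b} → c ℕ.≤ b → b ℕ.≤ a → c ℕ.≤ 3
  bound c≤b b≤a = ℕP.≤-trans c≤b (ℕP.≤-trans b≤a a≤3)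
  fact-suc' : fact (suc k) ≡ (y ℚ.+ 1ℚ) ℚ.* G
  fact-suc' = trans (fact-suc k) (cong (ℚ._* G) (fromℕ-suc k))
E-closed zero (suc (suc (suc (suc _)))) (s≤s (s≤s (s≤s ())))

quot-recurrence : ∀ m → m ℕ.≤ 3 → ∀ y →
  Σ< (suc m) (λ j → denQ j y ℚ.* quotQ (m ∸ j) y) ≡ binomQ m (y ℚ.* y)
quot-recurrence 0 _ = solve 1 (λ y → sumP 1 (λ j → denP j y :* quotP (0 ∸ j) y) := binomP 0 (y :* y)) refl
quot-recurrence 1 _ = solve 1 (λ y → sumP 2 (λ j → denP j y :* quotP (1 ∸ j) y) := binomP 1 (y :* y)) refl
quot-recurrence 2 _ = solve 1 (λ y → sumP 3 (λ j → denP j y :* quotP (2 ∸ j) y) := binomP 2 (y :* y)) refl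
quot-recurrence 3 _ = solve 1 (λ y → sumP 4 (λ j → denP j y :* quotP (3 ∸ j) y) := binomP 3 (y :* y)) refl
quot-recurrence (suc (suc (suc (suc _)))) (s≤s (s≤s (s≤s ())))

denD-lowest : ∀ k → inv! k ℚ.* inv! k ℚ.* taylor (denD k) (twice k) ≡ 1ℚ
denD-lowest k = begin
  u ℚ.* u ℚ.* taylor (denD k) (twice k)
    ≡⟨ cong (λ i → u ℚ.* u ℚ.* taylor (denD k) i) (sym (ℕP.+-identityʳ (twice k))) ⟩
  u ℚ.* u ℚ.* taylor (denD k) (twice k ℕ.+ 0)
    ≡⟨ cong (u ℚ.* u ℚ.*_) (trans (denD-at k 0) (E-closed k 0 z≤n)) ⟩
  u ℚ.* u ℚ.* (G ℚ.* G ℚ.* 1ℚ)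
    ≡⟨ solve 2 (λ U G → U :* U :* (G :* G :* con 1ℚ) := (U :* G) :* (U :* G)) refl u G ⟩
  (u ℚ.* G) ℚ.* (u ℚ.* G)
    ≡⟨ cong₂ ℚ._*_ (inv!-fact k) (inv!-fact k) ⟩
  1ℚ ∎
  where
  u = inv! k
  G = fact k

module Denominator (k : ℕ) =
  ConvolutionEquation (taylor (denD k)) (length (shift1 (denD k))) (coeff-beyond (shift1 (denD k)))
                      (twice k) (denD-below k) (inv! k ℚ.* inv! k) (denD-lowest k)

laurent-exists : ∀ k → ∃ (IsLaurentExpansionD k)
laurent-exists k = c , (twice k , vanishesBelow-to-ℤ (twice k) c c-vanishes) , c-solves
  where
  open Denominator k
  open Construction (coeffℤ (shift1 (numD k))) (λ _ → refl)

leading : ∀ k c → IsLaurentExpansionD k c → ∀ m → m ℕ.≤ 3 →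
          c (m ⊖ twice k) ≡ inv! k ℚ.* inv! k ℚ.* quotQ m (fromℕ k)
leading k c (bounded , solves) = <-rec Claim step
  where
  open Denominator k
  open Solution (coeffℤ (shift1 (numD k))) (λ _ → refl) c bounded solves
  G = fact k
  u = inv! k
  y = fromℕ k
  F : ℕ → ℚ
  F i = c (i ⊖ twice k)
  target : ℕ → ℚ
  target i = u ℚ.* u ℚ.* quotQ i y
  Claim : ℕ → Set
  Claim m = m ℕ.≤ 3 → F m ≡ target m

  unnormalise : ∀ x → u ℚ.* u ℚ.* (G ℚ.* G ℚ.* x) ≡ x
  unnormalise x = begin
    u ℚ.* u ℚ.* (G ℚ.* G ℚ.* x)    ≡⟨ solve 3 (λ U G X → U :* U :* (G :* G :* X) := (U :* G) :* (U :* G) :* X)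
                                         refl u G x ⟩
    (u ℚ.* G) ℚ.* (u ℚ.* G) ℚ.* x  ≡⟨ cong (λ a → a ℚ.* a ℚ.* x) (inv!-fact k) ⟩
    1ℚ ℚ.* 1ℚ ℚ.* x                ≡⟨ ℚP.*-identityˡ x ⟩
    x                              ∎

  system : ∀ m → m ℕ.≤ 3 →
    Σ< (suc m) (λ j → denQ j y ℚ.* F (m ∸ j)) ≡ Σ< (suc m) (λ j → denQ j y ℚ.* target (m ∸ j))
  system m m≤3 = begin
    Σ< (suc m) (λ j → denQ j y ℚ.* F (m ∸ j))
      ≡⟨ Σ<-ext (suc m) (λ j j≤m → sym (normalised j (ℕP.≤-trans (ℕP.≤-pred j≤m) m≤3))) ⟩
    Σ< (suc m) (λ j → u ℚ.* u ℚ.* (e j ℚ.* F (m ∸ j)))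
      ≡⟨ Σ<-scale (suc m) (u ℚ.* u) (λ j → e j ℚ.* F (m ∸ j)) ⟩
    u ℚ.* u ℚ.* Σ< (suc m) (λ j → e j ℚ.* F (m ∸ j))
      ≡⟨ cong (u ℚ.* u ℚ.*_) (triangular m) ⟩
    u ℚ.* u ℚ.* binom (k ℕ.* k) m
      ≡⟨ cong (u ℚ.* u ℚ.*_) (trans (binom-closed (k ℕ.* k) m (ℕP.m≤n⇒m≤1+n m≤3))
                                    (cong (binomQ m) (fromℕ-* k k))) ⟩
    u ℚ.* u ℚ.* binomQ m (y ℚ.* y)
      ≡⟨ cong (u ℚ.* u ℚ.*_) (sym (quot-recurrence m m≤3 y)) ⟩
    u ℚ.* u ℚ.* Σ< (suc m) (λ j → denQ j y ℚ.* quotQ (m ∸ j) y)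
      ≡⟨ sym (Σ<-scale (suc m) (u ℚ.* u) (λ j → denQ j y ℚ.* quotQ (m ∸ j) y)) ⟩
    Σ< (suc m) (λ j → u ℚ.* u ℚ.* (denQ j y ℚ.* quotQ (m ∸ j) y))
      ≡⟨ Σ<-ext (suc m) (λ j _ → solve 3 (λ U P Q → U :* U :* (P :* Q) := P :* (U :* U :* Q))
                                          refl u (denQ j y) (quotQ (m ∸ j) y)) ⟩
    Σ< (suc m) (λ j → denQ j y ℚ.* target (m ∸ j)) ∎
    where
    normalised : ∀ j → j ℕ.≤ 3 → u ℚ.* u ℚ.* (e j ℚ.* F (m ∸ j)) ≡ denQ j y ℚ.* F (m ∸ j)
    normalised j j≤3 = begin
      u ℚ.* u ℚ.* (e j ℚ.* F (m ∸ j))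
        ≡⟨ cong (λ x → u ℚ.* u ℚ.* (x ℚ.* F (m ∸ j))) (trans (denD-at k j) (E-closed k j j≤3)) ⟩
      u ℚ.* u ℚ.* (G ℚ.* G ℚ.* denQ j y ℚ.* F (m ∸ j))
        ≡⟨ cong (u ℚ.* u ℚ.*_) (ℚP.*-assoc (G ℚ.* G) (denQ j y) (F (m ∸ j))) ⟩
      u ℚ.* u ℚ.* (G ℚ.* G ℚ.* (denQ j y ℚ.* F (m ∸ j)))
        ≡⟨ unnormalise (denQ j y ℚ.* F (m ∸ j)) ⟩
      denQ j y ℚ.* F (m ∸ j) ∎

  step : ∀ m → (∀ {i} → i ℕ.< m → Claim i) → Claim m
  step m earlier m≤3 = triangular-unique m (λ j → denQ j y) F target refl
    (λ i i<m → earlier i<m (ℕP.≤-trans (ℕP.<⇒≤ i<m) m≤3)) (system m m≤3)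

leading-at : ∀ k c → IsLaurentExpansionD k c → ∀ m → m ℕ.≤ 3 → m ℕ.≤ 2 ℕ.* k →
             c (ℤ.- (+ (2 ℕ.* k ∸ m))) ≡ inv! k ℚ.* inv! k ℚ.* quotQ m (fromℕ k)
leading-at k c expansion m m≤3 m≤2k = trans (cong c (sym index)) (leading k c expansion m m≤3)
  where
  index : m ⊖ twice k ≡ ℤ.- (+ (2 ℕ.* k ∸ m))
  index = trans (cong (m ⊖_) (twice≡2* k)) (m⊖n≡-[n∸m] m (2 ℕ.* k) m≤2k)

½ 1/72 1/144 : ℚ
½ = + 1 ℚ./ 2
1/72 = + 1 ℚ./ 72
1/144 = + 1 ℚ./ 144

inv!-pred₂ : ∀ n → inv! n ℚ.* inv! (suc (suc n))
  ≡ fromℕ (suc n) ℚ.* ((fromℕ (suc n) ℚ.+ 1ℚ) ℚ.* inv! (suc (suc n))) ℚ.* inv! (suc (suc n))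
inv!-pred₂ n = cong (ℚ._* inv! (suc (suc n)))
  (trans (inv!-pred n) (cong (fromℕ (suc n) ℚ.*_)
    (trans (inv!-pred (suc n)) (cong (ℚ._* inv! (suc (suc n))) (fromℕ-suc (suc n))))))

coeff-2k : ∀ k c → IsLaurentExpansionD k c → c (ℤ.- (+ (2 ℕ.* k))) ≡ inv! k ℚ.* inv! k
coeff-2k k c expansion = trans (leading-at k c expansion 0 z≤n z≤n) (ℚP.*-identityʳ _)

coeff-2k-1 : ∀ k c → IsLaurentExpansionD (suc k) c →
  c (ℤ.- (+ (2 ℕ.* suc k ∸ 1))) ≡ ((+ (suc k ℕ.+ 1)) ℚ./ 2) ℚ.* (inv! (suc k ∸ 1) ℚ.* inv! (suc k))
coeff-2k-1 k c expansion = begin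
  c (ℤ.- (+ (2 ℕ.* suc k ∸ 1)))
    ≡⟨ leading-at (suc k) c expansion 1 (s≤s z≤n) (s≤s z≤n) ⟩
  u ℚ.* u ℚ.* quotQ 1 y
    ≡⟨ solve 2 (λ U Y → U :* U :* quotP 1 Y := ((Y :+ con (fromℕ 1)) :* con ½) :* ((Y :* U) :* U))
         refl u y ⟩
  ((y ℚ.+ fromℕ 1) ℚ.* ½) ℚ.* ((y ℚ.* u) ℚ.* u)
    ≡⟨ sym (cong₂ ℚ._*_ (trans (/-as-* (+ (suc k ℕ.+ 1)) 2 ½ refl) (cong (ℚ._* ½) (fromℕ-+ (suc k) 1)))
                        (cong (ℚ._* u) (inv!-pred k))) ⟩
  ((+ (suc k ℕ.+ 1)) ℚ./ 2) ℚ.* (inv! k ℚ.* u) ∎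
  where
  u = inv! (suc k)
  y = fromℕ (suc k)

numerator-2 : ∀ K → fromℕ (9 ℕ.* K ℕ.* K ℕ.+ 25 ℕ.* K ℕ.+ 13)
  ≡ fromℕ 9 ℚ.* fromℕ K ℚ.* fromℕ K ℚ.+ fromℕ 25 ℚ.* fromℕ K ℚ.+ fromℕ 13
numerator-2 K = trans (fromℕ-+ (9 ℕ.* K ℕ.* K ℕ.+ 25 ℕ.* K) 13)
  (cong (ℚ._+ fromℕ 13) (trans (fromℕ-+ (9 ℕ.* K ℕ.* K) (25 ℕ.* K))
    (cong₂ ℚ._+_ (trans (fromℕ-* (9 ℕ.* K) K) (cong (ℚ._* fromℕ K) (fromℕ-* 9 K))) (fromℕ-* 25 K))))

numerator-3 : ∀ K →
  fromℤ ((+ (3 ℕ.* K ℕ.^ 4 ℕ.+ 10 ℕ.* K ℕ.^ 3)) ℤ.- (+ (4 ℕ.* K ℕ.^ 2 ℕ.+ 31 ℕ.* K ℕ.+ 14)))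
  ≡ (fromℕ 3 ℚ.* pow (fromℕ K) 4 ℚ.+ fromℕ 10 ℚ.* pow (fromℕ K) 3)
    ℚ.- (fromℕ 4 ℚ.* pow (fromℕ K) 2 ℚ.+ fromℕ 31 ℚ.* fromℕ K ℚ.+ fromℕ 14)
numerator-3 K = trans (fromℤ-+ (+ A) (ℤ.- (+ B))) (cong₂ ℚ._+_ A≡ (trans (fromℤ-neg (+ B)) (cong ℚ.-_ B≡)))
  where
  A = 3 ℕ.* K ℕ.^ 4 ℕ.+ 10 ℕ.* K ℕ.^ 3
  B = 4 ℕ.* K ℕ.^ 2 ℕ.+ 31 ℕ.* K ℕ.+ 14
  monomial : ∀ a n → fromℕ (a ℕ.* K ℕ.^ n) ≡ fromℕ a ℚ.* pow (fromℕ K) n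
  monomial a n = trans (fromℕ-* a (K ℕ.^ n)) (cong (fromℕ a ℚ.*_) (fromℕ-^ K n))
  A≡ : fromℕ A ≡ fromℕ 3 ℚ.* pow (fromℕ K) 4 ℚ.+ fromℕ 10 ℚ.* pow (fromℕ K) 3
  A≡ = trans (fromℕ-+ (3 ℕ.* K ℕ.^ 4) (10 ℕ.* K ℕ.^ 3)) (cong₂ ℚ._+_ (monomial 3 4) (monomial 10 3))
  B≡ : fromℕ B ≡ fromℕ 4 ℚ.* pow (fromℕ K) 2 ℚ.+ fromℕ 31 ℚ.* fromℕ K ℚ.+ fromℕ 14
  B≡ = trans (fromℕ-+ (4 ℕ.* K ℕ.^ 2 ℕ.+ 31 ℕ.* K) 14)
    (cong (ℚ._+ fromℕ 14) (trans (fromℕ-+ (4 ℕ.* K ℕ.^ 2) (31 ℕ.* K))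
      (cong₂ ℚ._+_ (monomial 4 2) (fromℕ-* 31 K))))

coeff-2k-2 : ∀ n c → let K = suc (suc n) in IsLaurentExpansionD K c →
  c (ℤ.- (+ (2 ℕ.* K ∸ 2)))
    ≡ ((+ (9 ℕ.* K ℕ.* K ℕ.+ 25 ℕ.* K ℕ.+ 13)) ℚ./ 72) ℚ.* (inv! (K ∸ 2) ℚ.* inv! K)
coeff-2k-2 n c expansion = begin
  c (ℤ.- (+ (2 ℕ.* K ∸ 2)))
    ≡⟨ leading-at K c expansion 2 (s≤s (s≤s z≤n)) (s≤s (s≤s z≤n)) ⟩
  u ℚ.* u ℚ.* quotQ 2 y
    ≡⟨ cong (λ x → u ℚ.* u ℚ.* quotQ 2 x) (fromℕ-suc (suc n)) ⟩
  u ℚ.* u ℚ.* quotQ 2 (z ℚ.+ 1ℚ)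
    ≡⟨ solve 2 (λ U Z → U :* U :* quotP 2 (Z :+ con 1ℚ)
         := (con (fromℕ 9) :* (Z :+ con 1ℚ) :* (Z :+ con 1ℚ) :+ con (fromℕ 25) :* (Z :+ con 1ℚ)
             :+ con (fromℕ 13)) :* con 1/72 :* (Z :* ((Z :+ con 1ℚ) :* U) :* U)) refl u z ⟩
  numerator (z ℚ.+ 1ℚ) ℚ.* 1/72 ℚ.* (z ℚ.* ((z ℚ.+ 1ℚ) ℚ.* u) ℚ.* u)
    ≡⟨ sym (cong₂ ℚ._*_ fraction (inv!-pred₂ n)) ⟩
  ((+ (9 ℕ.* K ℕ.* K ℕ.+ 25 ℕ.* K ℕ.+ 13)) ℚ./ 72) ℚ.* (inv! n ℚ.* u) ∎
  where
  K = suc (suc n)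
  u = inv! K
  y = fromℕ K
  z = fromℕ (suc n)
  numerator : ℚ → ℚ
  numerator x = fromℕ 9 ℚ.* x ℚ.* x ℚ.+ fromℕ 25 ℚ.* x ℚ.+ fromℕ 13
  fraction : (+ (9 ℕ.* K ℕ.* K ℕ.+ 25 ℕ.* K ℕ.+ 13)) ℚ./ 72 ≡ numerator (z ℚ.+ 1ℚ) ℚ.* 1/72
  fraction = trans (/-as-* (+ (9 ℕ.* K ℕ.* K ℕ.+ 25 ℕ.* K ℕ.+ 13)) 72 1/72 refl)
    (cong (ℚ._* 1/72) (trans (numerator-2 K) (cong numerator (fromℕ-suc (suc n)))))

coeff-2k-3 : ∀ n c → let K = suc (suc n) in IsLaurentExpansionD K c →
  c (ℤ.- (+ (2 ℕ.* K ∸ 3)))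
    ≡ (((+ (3 ℕ.* K ℕ.^ 4 ℕ.+ 10 ℕ.* K ℕ.^ 3)) ℤ.- (+ (4 ℕ.* K ℕ.^ 2 ℕ.+ 31 ℕ.* K ℕ.+ 14))) ℚ./ 144)
        ℚ.* (inv! (K ∸ 2) ℚ.* inv! K)
coeff-2k-3 n c expansion = begin
  c (ℤ.- (+ (2 ℕ.* K ∸ 3)))
    ≡⟨ leading-at K c expansion 3 (s≤s (s≤s (s≤s z≤n)))
         (ℕP.≤-trans (s≤s (s≤s (s≤s z≤n))) (ℕP.≤-reflexive (twice≡2* K))) ⟩
  u ℚ.* u ℚ.* quotQ 3 y
    ≡⟨ cong (λ x → u ℚ.* u ℚ.* quotQ 3 x) (fromℕ-suc (suc n)) ⟩
  u ℚ.* u ℚ.* quotQ 3 (z ℚ.+ 1ℚ)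
    ≡⟨ solve 2 (λ U Z → U :* U :* quotP 3 (Z :+ con 1ℚ)
         := ((con (fromℕ 3) :* powP (Z :+ con 1ℚ) 4 :+ con (fromℕ 10) :* powP (Z :+ con 1ℚ) 3)
             :- (con (fromℕ 4) :* powP (Z :+ con 1ℚ) 2 :+ con (fromℕ 31) :* (Z :+ con 1ℚ)
                 :+ con (fromℕ 14)))
            :* con 1/144 :* (Z :* ((Z :+ con 1ℚ) :* U) :* U)) refl u z ⟩
  numerator (z ℚ.+ 1ℚ) ℚ.* 1/144 ℚ.* (z ℚ.* ((z ℚ.+ 1ℚ) ℚ.* u) ℚ.* u)
    ≡⟨ sym (cong₂ ℚ._*_ fraction (inv!-pred₂ n)) ⟩
  ((+ A ℤ.- + B) ℚ./ 144) ℚ.* (inv! n ℚ.* u) ∎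
  where
  K = suc (suc n)
  A = 3 ℕ.* K ℕ.^ 4 ℕ.+ 10 ℕ.* K ℕ.^ 3
  B = 4 ℕ.* K ℕ.^ 2 ℕ.+ 31 ℕ.* K ℕ.+ 14
  u = inv! K
  y = fromℕ K
  z = fromℕ (suc n)
  numerator : ℚ → ℚ
  numerator x = (fromℕ 3 ℚ.* pow x 4 ℚ.+ fromℕ 10 ℚ.* pow x 3)
                ℚ.- (fromℕ 4 ℚ.* pow x 2 ℚ.+ fromℕ 31 ℚ.* x ℚ.+ fromℕ 14)
  fraction : (+ A ℤ.- + B) ℚ./ 144 ≡ numerator (z ℚ.+ 1ℚ) ℚ.* 1/144
  fraction = trans (/-as-* (+ A ℤ.- + B) 144 1/144 refl)
    (cong (ℚ._* 1/144) (trans (numerator-3 K) (cong numerator (fromℕ-suc (suc n)))))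

mainTheorem3 : (∀ (k : ℕ) → ∃ (IsLaurentExpansionD k))
    × (∀ (k : ℕ) (c : ℤ → ℚ) → k ≥ 1 → IsLaurentExpansionD k c →
         (c (ℤ.- (+ (2 ℕ.* k))) ≡ inv! k ℚ.* inv! k)
         × (c (ℤ.- (+ (2 ℕ.* k ∸ 1)))
              ≡ ((+ (k ℕ.+ 1)) ℚ./ 2) ℚ.* (inv! (k ∸ 1) ℚ.* inv! k)))
    × (∀ (k : ℕ) (c : ℤ → ℚ) → k ≥ 2 → IsLaurentExpansionD k c →
         (c (ℤ.- (+ (2 ℕ.* k ∸ 2)))
            ≡ ((+ (9 ℕ.* k ℕ.* k ℕ.+ 25 ℕ.* k ℕ.+ 13)) ℚ./ 72)
                ℚ.* (inv! (k ∸ 2) ℚ.* inv! k))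
         × (c (ℤ.- (+ (2 ℕ.* k ∸ 3)))
            ≡ (((+ (3 ℕ.* k ℕ.^ 4 ℕ.+ 10 ℕ.* k ℕ.^ 3))
                  ℤ.- (+ (4 ℕ.* k ℕ.^ 2 ℕ.+ 31 ℕ.* k ℕ.+ 14))) ℚ./ 144)
                ℚ.* (inv! (k ∸ 2) ℚ.* inv! k)))
mainTheorem3 =
    laurent-exists
  , (λ { zero c () _
       ; (suc k) c _ expansion → coeff-2k (suc k) c expansion , coeff-2k-1 k c expansion })
  , (λ { zero c () _
       ; (suc zero) c (s≤s ()) _
       ; (suc (suc n)) c _ expansion → coeff-2k-2 n c expansion , coeff-2k-3 n c expansion })
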